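{- Let $G$ be a finite non-simple group, let $|L(G)|$ be the number of subgroups of $G$, and let $r$ be the number of proper normal subgroups of $G$ (normal subgroups different from $\{1\}$ and $G$). Suppose $r\neq |L(G)|-2$. Then: (i) for every vertex $H$ of $\Gamma(G)$, $\deg_{\Gamma(G)}(H)=|L(G)|-3$ if $H$ is normal in $G$, and $\deg_{\Gamma(G)}(H)=r+\deg_{\Gamma_N(G)}(H)$ otherwise; (ii) $|E(\Gamma(G))|=|E(\Gamma_N(G))|+\frac{r}{2}\,(2|L(G)|-r-5)$; (iii) $\alpha(\Gamma(G))=\alpha(\Gamma_N(G))$; (iv) $\omega(\Gamma(G))=r+\omega(\Gamma_N(G))$; (v) $\chi(\Gamma(G))=r+\chi(\Gamma_N(G))$; (vi) $\gamma(\Gamma(G))=1$.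
   Context: For a group $G$, $\Gamma(G)$ is the simple graph whose vertices are the subgroups of $G$ other than $\{1\}$ and $G$, two distinct vertices $H,K$ being adjacent iff $HK=KH$. $\Gamma_N(G)$ is the simple graph whose vertices are the proper non-normal subgroups of $G$, with the same adjacency rule. $\alpha$, $\omega$, $\chi$, $\gamma$ denote the independence number, clique number, chromatic number and domination number of a graph; $E(\cdot)$ is the edge set. -}

module Defs where

open import Level using (0ℓ)
open import Data.Nat using (ℕ; _≤_)
open import Data.Fin using (Fin)
open import Data.Product using (Σ; ∃; _×_; _,_)
open import Data.Sum using (_⊎_)
open import Data.List using (List; length)
open import Data.List.Membership.Propositional using () renaming (_∈_ to _∈ₗ_; _∉_ to _∉ₗ_)
open import Data.List.Relation.Unary.All using (All)
open import Data.List.Relation.Unary.AllPairs using (AllPairs)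
open import Data.List.Relation.Unary.Unique.Propositional using (Unique)
open import Data.Fin.Subset using (Subset; ⁅_⁆) renaming (_∈_ to _∈ₛ_; ⊤ to Full)
open import Relation.Nullary using (¬_)
open import Relation.Binary.PropositionalEquality using (_≡_; _≢_)
open import Algebra.Structures using (IsGroup)
open import Function.Bundles using (_⇔_)

-- Finite groups: a group whose carrier is Fin n (every finite group is
-- isomorphic to one of this form), with propositional equality.

record FinGroup (n : ℕ) : Set where
  field
    _∙_     : Fin n → Fin n → Fin n
    ε       : Fin n
    _⁻¹     : Fin n → Fin n
    isGroup : IsGroup _≡_ _∙_ ε _⁻¹

module _ {n : ℕ} (G : FinGroup n) where
  open FinGroup G

  IsSubgroup : Subset n → Set
  IsSubgroup H = (ε ∈ₛ H)
               × (∀ x y → x ∈ₛ H → y ∈ₛ H → (x ∙ y) ∈ₛ H)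
               × (∀ x → x ∈ₛ H → (x ⁻¹) ∈ₛ H)

  Trivial : Subset n
  Trivial = ⁅ ε ⁆

  IsNormal : Subset n → Set
  IsNormal H = IsSubgroup H × (∀ g h → h ∈ₛ H → ((g ∙ h) ∙ (g ⁻¹)) ∈ₛ H)

  IsProperNormal : Subset n → Set
  IsProperNormal H = IsNormal H × H ≢ Trivial × H ≢ Full

  NonSimple : Set
  NonSimple = ∃ IsProperNormal

  Permute : Subset n → Subset n → Set
  Permute H K =
      (∀ h k → h ∈ₛ H → k ∈ₛ K → ∃ λ k' → ∃ λ h' → k' ∈ₛ K × h' ∈ₛ H × (h ∙ k) ≡ (k' ∙ h'))
    × (∀ k h → k ∈ₛ K → h ∈ₛ H → ∃ λ h' → ∃ λ k' → h' ∈ₛ H × k' ∈ₛ K × (k ∙ h) ≡ (h' ∙ k'))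

record Graph (V : Set) : Set₁ where
  field
    Vtx : V → Set
    Adj : V → V → Set

module _ {n : ℕ} (G : FinGroup n) where

  Γ : Graph (Subset n)
  Γ = record
    { Vtx = λ H → IsSubgroup G H × H ≢ Trivial G × H ≢ Full
    ; Adj = λ H K → H ≢ K × Permute G H K }

  ΓN : Graph (Subset n)
  ΓN = record
    { Vtx = λ H → IsSubgroup G H × ¬ IsNormal G H × H ≢ Full
    ; Adj = λ H K → H ≢ K × Permute G H K }

Enumerates : {A : Set} → (A → Set) → List A → Set
Enumerates P xs = Unique xs × (∀ a → (P a ⇔ (a ∈ₗ xs)))

HasCount : {A : Set} → (A → Set) → ℕ → Set
HasCount P k = ∃ λ xs → Enumerates P xs × length xs ≡ k

module _ {V : Set} (Γ : Graph V) where
  open Graph Γ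

  HasDegree : V → ℕ → Set
  HasDegree v d = HasCount (λ w → Vtx w × Adj v w) d

  -- |E| = e : a duplicate-free list of ordered pairs containing exactly one
  -- orientation of every edge
  HasEdgeCount : ℕ → Set
  HasEdgeCount e = ∃ λ (ps : List (V × V)) →
      Unique ps
    × (∀ v w → (v , w) ∈ₗ ps → Vtx v × Vtx w × Adj v w × (w , v) ∉ₗ ps)
    × (∀ v w → Vtx v → Vtx w → Adj v w → ((v , w) ∈ₗ ps ⊎ (w , v) ∈ₗ ps))
    × length ps ≡ e

  VertexSet : List V → Set
  VertexSet xs = Unique xs × All Vtx xs

  Independent : List V → Set
  Independent xs = VertexSet xs × AllPairs (λ v w → ¬ Adj v w) xs

  Clique : List V → Set
  Clique xs = VertexSet xs × AllPairs Adj xs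

  Dominating : List V → Set
  Dominating xs = VertexSet xs × (∀ v → Vtx v → v ∈ₗ xs ⊎ ∃ λ w → w ∈ₗ xs × Adj w v)

  ProperColouring : (k : ℕ) → (V → Fin k) → Set
  ProperColouring k c = ∀ v w → Vtx v → Vtx w → Adj v w → c v ≢ c w

  IsIndependenceNumber : ℕ → Set
  IsIndependenceNumber a =
    (∃ λ xs → Independent xs × length xs ≡ a) × (∀ xs → Independent xs → length xs ≤ a)

  IsCliqueNumber : ℕ → Set
  IsCliqueNumber a =
    (∃ λ xs → Clique xs × length xs ≡ a) × (∀ xs → Clique xs → length xs ≤ a)

  IsChromaticNumber : ℕ → Set
  IsChromaticNumber a =
    (∃ λ c → ProperColouring a c) × (∀ k c → ProperColouring k c → a ≤ k)

  IsDominationNumber : ℕ → Set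
  IsDominationNumber a =
    (∃ λ xs → Dominating xs × length xs ≡ a) × (∀ xs → Dominating xs → a ≤ length xs)

module Submission where

-- Let G be finite and non-simple, U the set of proper normal
-- subgroups (|U| = r) and R the set of proper non-normal subgroups, i.e. the
-- vertex set of Γ_N(G).  A normal subgroup N permutes with every subgroup
-- (NK = KN), so every vertex of U is adjacent to every other vertex of Γ(G);
-- and Γ(G) restricted to R is exactly Γ_N(G).  Thus Γ(G) is the join of the
-- complete graph on U with Γ_N(G), and all six statements are facts about
-- such joins.  The hypothesis r ≠ |L(G)| - 2 says precisely that R ≠ ∅.

open import Defs
open import Level using (0ℓ)
open import Data.Nat using (ℕ; zero; suc; _+_; _*_; _∸_; _≤_; z≤n; s≤s)
open import Data.Nat.Properties using (≤-antisym; +-suc; +-identityʳ; +-comm; +-assoc; +-mono-≤; +-monoʳ-≤)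
open import Data.Integer using (ℤ; +_; _-_) renaming (_+_ to _+ℤ_; _*_ to _*ℤ_)
import Data.Integer.Properties as ℤ
open import Data.Integer.Solver using (module +-*-Solver)
open import Data.Fin as Fin using (Fin; punchOut; splitAt; join)
open import Data.Fin.Properties using (punchOut-injective; splitAt-join; all?)
open import Data.Fin.Subset using (Subset; _⊆_) renaming (_∈_ to _∈ₛ_; ⊤ to Full)
open import Data.Fin.Subset.Properties using (_∈?_; x∈⁅x⁆; x∈⁅y⁆⇒x≡y; ∈⊤; ⊆-antisym)
import Data.Bool as Bool
import Data.Vec.Properties as Vec
open import Data.List using (List; []; _∷_; length; _++_; map; filter; cartesianProduct; lookup)
open import Data.List.Properties using (length-++; length-map)
open import Data.List.Membership.Propositional using (_∈_)
open import Data.List.Membership.Propositional.Properties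
  using (∈-++⁺ˡ; ∈-++⁺ʳ; ∈-++⁻; ∈-∃++; ∈-map⁺; ∈-map⁻; ∈-filter⁺; ∈-filter⁻;
         ∈-cartesianProduct⁺; ∈-cartesianProduct⁻; ∈-AllPairs₂)
open import Data.List.Relation.Unary.Any using (here; there; index)
open import Data.List.Relation.Unary.Any.Properties using (lookup-index)
open import Data.List.Relation.Unary.All as All using (All; []; _∷_)
import Data.List.Relation.Unary.All.Properties as All
open import Data.List.Relation.Unary.AllPairs using (AllPairs; []; _∷_)
import Data.List.Relation.Unary.AllPairs.Properties as AllPairs
open import Data.List.Relation.Unary.Unique.Propositional using (Unique)
import Data.List.Relation.Unary.Unique.Propositional.Properties as Unique
open import Data.Product using (∃; ∃₂; _×_; _,_; proj₁; proj₂; swap)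
open import Data.Sum using (_⊎_; inj₁; inj₂)
open import Data.Sum.Properties using (inj₁-injective; inj₂-injective)
open import Data.Empty using (⊥; ⊥-elim)
open import Relation.Nullary using (¬_; yes; no; ¬?)
open import Relation.Nullary.Decidable using (_×-dec_; _→-dec_)
open import Relation.Unary using (Decidable)
open import Relation.Binary.Definitions using (DecidableEquality)
open import Relation.Binary.PropositionalEquality
open import Function.Bundles using (_⇔_; mk⇔; Equivalence)
open import Algebra.Structures using (IsGroup)
open import Algebra.Bundles using (Group)
import Algebra.Properties.Group as GroupProperties

open Equivalence using (to; from)

-- 1. Counting with duplicate-free enumerations.

module _ {A : Set} where

  length-≤-⊆ : ∀ {xs ys : List A} → Unique xs → (∀ {a} → a ∈ xs → a ∈ ys) → length xs ≤ length ys
  length-≤-⊆ {[]} _ _ = z≤n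
  length-≤-⊆ {x ∷ xs} {ys} (x∉xs ∷ uxs) xs⊆ys with ∈-∃++ (xs⊆ys (here refl))
  ... | us , vs , refl = subst (suc (length xs) ≤_) (sym length-split) (s≤s (length-≤-⊆ uxs xs⊆us++vs))
    where
    length-split : length (us ++ x ∷ vs) ≡ suc (length (us ++ vs))
    length-split = begin
      length (us ++ x ∷ vs)          ≡⟨ length-++ us ⟩
      length us + suc (length vs)    ≡⟨ +-suc (length us) (length vs) ⟩
      suc (length us + length vs)    ≡⟨ cong suc (length-++ us) ⟨
      suc (length (us ++ vs))        ∎
      where open ≡-Reasoning
    xs⊆us++vs : ∀ {a} → a ∈ xs → a ∈ us ++ vs
    xs⊆us++vs a∈xs with ∈-++⁻ us (xs⊆ys (there a∈xs))
    ... | inj₁ a∈us         = ∈-++⁺ˡ a∈us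
    ... | inj₂ (here refl)  = ⊥-elim (All.lookup x∉xs a∈xs refl)
    ... | inj₂ (there a∈vs) = ∈-++⁺ʳ us a∈vs

  count-unique : ∀ {P : A → Set} {k l} → HasCount P k → HasCount P l → k ≡ l
  count-unique (xs , (uxs , xs-enum) , refl) (ys , (uys , ys-enum) , refl) =
    ≤-antisym (length-≤-⊆ uxs (λ {a} a∈xs → to (ys-enum a) (from (xs-enum a) a∈xs)))
              (length-≤-⊆ uys (λ {a} a∈ys → to (xs-enum a) (from (ys-enum a) a∈ys)))

  count-resp : ∀ {P Q : A → Set} {k} → (∀ a → P a ⇔ Q a) → HasCount P k → HasCount Q k
  count-resp P⇔Q (xs , (uxs , enum) , len) =
    xs , (uxs , λ a → mk⇔ (λ qa → to (enum a) (from (P⇔Q a) qa)) (λ a∈ → to (P⇔Q a) (from (enum a) a∈))) , len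

  count-members : ∀ {xs : List A} → Unique xs → HasCount (_∈ xs) (length xs)
  count-members {xs} uxs = xs , (uxs , λ _ → mk⇔ (λ a∈ → a∈) (λ a∈ → a∈)) , refl

  count-singleton : ∀ (a : A) → HasCount (_≡ a) 1
  count-singleton a = a ∷ [] , (([] ∷ []) , λ b → mk⇔ (λ { refl → here refl }) (λ { (here b≡a) → b≡a })) , refl

  count-⊎ : ∀ {P Q : A → Set} {k l} → (∀ {a} → P a → Q a → ⊥) →
            HasCount P k → HasCount Q l → HasCount (λ a → P a ⊎ Q a) (k + l)
  count-⊎ {P} {Q} disjoint (xs , (uxs , xs-enum) , refl) (ys , (uys , ys-enum) , refl) =
    xs ++ ys , (Unique.++⁺ uxs uys separated , enum) , length-++ xs
    where
    separated : ∀ {a} → ¬ (a ∈ xs × a ∈ ys)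
    separated {a} (a∈xs , a∈ys) = disjoint (from (xs-enum a) a∈xs) (from (ys-enum a) a∈ys)
    enum : ∀ a → (P a ⊎ Q a) ⇔ (a ∈ xs ++ ys)
    enum a = mk⇔ into out
      where
      into : P a ⊎ Q a → a ∈ xs ++ ys
      into (inj₁ pa) = ∈-++⁺ˡ (to (xs-enum a) pa)
      into (inj₂ qa) = ∈-++⁺ʳ xs (to (ys-enum a) qa)
      out : a ∈ xs ++ ys → P a ⊎ Q a
      out a∈ with ∈-++⁻ xs a∈
      ... | inj₁ a∈xs = inj₁ (from (xs-enum a) a∈xs)
      ... | inj₂ a∈ys = inj₂ (from (ys-enum a) a∈ys)

  count-filter : ∀ {P Q : A → Set} {k} → Decidable Q → HasCount P k → ∃ λ l → HasCount (λ a → P a × Q a) l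
  count-filter {P} {Q} Q? (xs , (uxs , enum) , _) =
    length (filter Q? xs) , (filter Q? xs , (Unique.filter⁺ Q? uxs , λ a → mk⇔ (into a) (out a)) , refl)
    where
    into : ∀ a → P a × Q a → a ∈ filter Q? xs
    into a (pa , qa) = ∈-filter⁺ Q? (to (enum a) pa) qa
    out : ∀ a → a ∈ filter Q? xs → P a × Q a
    out a a∈ = let (a∈xs , qa) = ∈-filter⁻ Q? {xs = xs} a∈ in from (enum a) a∈xs , qa

  count-nonzero : ∀ {P : A → Set} {k} → HasCount P (suc k) → ∃ P
  count-nonzero (a ∷ _ , (_ , enum) , _) = a , from (enum a) (here refl)

  count-diagonal : ∀ {P : A → Set} {k} → HasCount P k → HasCount (λ ((a , b) : A × A) → P a × a ≡ b) k
  count-diagonal {P} (xs , (uxs , enum) , refl) =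
    map diagonal xs , (Unique.map⁺ (cong proj₁) uxs , λ x → mk⇔ (into x) (out x)) , length-map diagonal xs
    where
    diagonal : A → A × A
    diagonal a = a , a
    into : ∀ x → P (proj₁ x) × proj₁ x ≡ proj₂ x → x ∈ map diagonal xs
    into (a , .a) (pa , refl) = ∈-map⁺ diagonal (to (enum a) pa)
    out : ∀ x → x ∈ map diagonal xs → P (proj₁ x) × proj₁ x ≡ proj₂ x
    out x x∈ with ∈-map⁻ diagonal x∈
    ... | a , a∈xs , refl = from (enum a) a∈xs , refl

  length-filter-split : ∀ {P : A → Set} (P? : Decidable P) xs →
    length (filter P? xs) + length (filter (λ a → ¬? (P? a)) xs) ≡ length xs
  length-filter-split P? [] = refl
  length-filter-split P? (x ∷ xs) with P? x
  ... | yes _ = cong suc (length-filter-split P? xs)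
  ... | no _  = trans (+-suc (length (filter P? xs)) _) (cong suc (length-filter-split P? xs))

module _ {A B : Set} where

  length-cartesianProduct : ∀ (xs : List A) (ys : List B) → length (cartesianProduct xs ys) ≡ length xs * length ys
  length-cartesianProduct []       ys = refl
  length-cartesianProduct (x ∷ xs) ys = begin
    length (map (x ,_) ys ++ cartesianProduct xs ys)          ≡⟨ length-++ (map (x ,_) ys) ⟩
    length (map (x ,_) ys) + length (cartesianProduct xs ys)  ≡⟨ cong₂ _+_ (length-map (x ,_) ys) (length-cartesianProduct xs ys) ⟩
    length ys + length xs * length ys                         ∎
    where open ≡-Reasoning

  count-× : ∀ {P : A → Set} {Q : B → Set} {k l} → HasCount P k → HasCount Q l →
            HasCount (λ ((a , b) : A × B) → P a × Q b) (k * l)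
  count-× {P} {Q} (xs , (uxs , xs-enum) , refl) (ys , (uys , ys-enum) , refl) =
    cartesianProduct xs ys , (Unique.cartesianProduct⁺ uxs uys , λ x → mk⇔ (into x) (out x)) ,
    length-cartesianProduct xs ys
    where
    into : ∀ x → P (proj₁ x) × Q (proj₂ x) → x ∈ cartesianProduct xs ys
    into (a , b) (pa , qb) = ∈-cartesianProduct⁺ (to (xs-enum a) pa) (to (ys-enum b) qb)
    out : ∀ x → x ∈ cartesianProduct xs ys → P (proj₁ x) × Q (proj₂ x)
    out (a , b) x∈ = let (a∈ , b∈) = ∈-cartesianProduct⁻ xs ys x∈ in from (xs-enum a) a∈ , from (ys-enum b) b∈

  count-swap : ∀ {P : A × B → Set} {k} → HasCount P k → HasCount (λ x → P (swap x)) k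
  count-swap {P} (xs , (uxs , enum) , refl) =
    map swap xs , (Unique.map⁺ (cong swap) uxs , λ x → mk⇔ (into x) (out x)) , length-map swap xs
    where
    into : ∀ x → P (swap x) → x ∈ map swap xs
    into x p = ∈-map⁺ swap (to (enum (swap x)) p)
    out : ∀ x → x ∈ map swap xs → P (swap x)
    out x x∈ with ∈-map⁻ swap x∈
    ... | y , y∈xs , refl = from (enum y) y∈xs

module _ {V : Set} (g : Graph V) where
  open Graph g

  Edge : V × V → Set
  Edge (v , w) = Vtx v × Vtx w × Adj v w

  edges-as-ordered-pairs : (∀ {v w} → Adj v w → Adj w v) → ∀ {e} → HasEdgeCount g e → HasCount Edge (2 * e)
  edges-as-ordered-pairs adj-sym {e} (ps , ups , sound , complete , refl) =
    subst (HasCount Edge) (cong (λ z → length ps + z) (sym (+-identityʳ (length ps))))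
      (count-resp (λ x → mk⇔ (into x) (out x))
        (count-⊎ not-both (count-members ups) (count-swap (count-members ups))))
    where
    not-both : ∀ {x} → x ∈ ps → swap x ∈ ps → ⊥
    not-both {v , w} x∈ swapx∈ = proj₂ (proj₂ (proj₂ (sound v w x∈))) swapx∈
    into : ∀ x → x ∈ ps ⊎ swap x ∈ ps → Edge x
    into (v , w) (inj₁ x∈) = let (vv , vw , adj , _) = sound v w x∈ in vv , vw , adj
    into (v , w) (inj₂ x∈) = let (vw , vv , adj , _) = sound w v x∈ in vv , vw , adj-sym adj
    out : ∀ x → Edge x → x ∈ ps ⊎ swap x ∈ ps
    out (v , w) (vv , vw , adj) = complete v w vv vw adj

  allPairs-of-distinct : ∀ {R : V → V → Set} {xs} → Unique xs →
    (∀ {x y} → x ∈ xs → y ∈ xs → x ≢ y → R x y) → AllPairs R xs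
  allPairs-of-distinct []            related = []
  allPairs-of-distinct (x∉xs ∷ uxs) related =
    All.tabulate (λ y∈ → related (here refl) (there y∈) (All.lookup x∉xs y∈))
    ∷ allPairs-of-distinct uxs (λ x∈ y∈ → related (there x∈) (there y∈))

-- Merge colour i of Fin (suc k) into a colour d ≢ i, obtaining k colours.
merge-colour : ∀ {k} (i d : Fin (suc k)) → i ≢ d → Fin (suc k) → Fin k
merge-colour i d i≢d j with i Fin.≟ j
... | yes _   = punchOut i≢d
... | no i≢j = punchOut i≢j

merge-colour-injective : ∀ {k} {i d j j' : Fin (suc k)} (i≢d : i ≢ d) → i ≢ j → i ≢ j' →
  merge-colour i d i≢d j ≡ merge-colour i d i≢d j' → j ≡ j'
merge-colour-injective {i = i} {j = j} {j'} i≢d i≢j i≢j' same with i Fin.≟ j | i Fin.≟ j'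
... | yes i≡j | _         = ⊥-elim (i≢j i≡j)
... | no _    | yes i≡j'  = ⊥-elim (i≢j' i≡j')
... | no i≢j₁ | no i≢j'₁  = punchOut-injective i≢j₁ i≢j'₁ same

module _ {V : Set} (g : Graph V) where
  open Graph g

  -- If the elements ms (not necessarily vertices of g) carry pairwise distinct
  -- colours that no vertex of g uses, these |ms| colours can be dropped: each
  -- is merged in turn into the colour of a fixed vertex w of g.
  drop-colours : ∀ {w} → Vtx w → (ms : List V) → Unique ms → ∀ k (c : V → Fin k) →
    (∀ {m v} → m ∈ ms → Vtx v → c v ≢ c m) →
    (∀ {m m'} → m ∈ ms → m' ∈ ms → m ≢ m' → c m ≢ c m') →
    ProperColouring g k c →
    ∃₂ λ k' (c' : V → Fin k') → ProperColouring g k' c' × k' + length ms ≡ k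
  drop-colours w∈g []       _ k c _ _ proper = k , c , proper , +-identityʳ k
  drop-colours w∈g (m ∷ ms) _ zero c _ _ _ with c m
  ... | ()
  drop-colours {w} w∈g (m ∷ ms) (m∉ms ∷ ums) (suc k) c unused distinct proper
    with drop-colours w∈g ms ums k merged unused' distinct' proper'
    where
    m≢w : c m ≢ c w
    m≢w cm≡cw = unused (here refl) w∈g (sym cm≡cw)
    merged : V → Fin k
    merged v = merge-colour (c m) (c w) m≢w (c v)
    off-vertex : ∀ {v} → Vtx v → c m ≢ c v
    off-vertex v∈g cm≡cv = unused (here refl) v∈g (sym cm≡cv)
    off-ms : ∀ {m'} → m' ∈ ms → c m ≢ c m'
    off-ms m'∈ = distinct (here refl) (there m'∈) (All.lookup m∉ms m'∈)
    unused' : ∀ {m' v} → m' ∈ ms → Vtx v → merged v ≢ merged m'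
    unused' m'∈ v∈g same = unused (there m'∈) v∈g (merge-colour-injective m≢w (off-vertex v∈g) (off-ms m'∈) same)
    distinct' : ∀ {m₁ m₂} → m₁ ∈ ms → m₂ ∈ ms → m₁ ≢ m₂ → merged m₁ ≢ merged m₂
    distinct' m₁∈ m₂∈ m₁≢m₂ same = distinct (there m₁∈) (there m₂∈) m₁≢m₂ (merge-colour-injective m≢w (off-ms m₁∈) (off-ms m₂∈) same)
    proper' : ProperColouring g k merged
    proper' v v' v∈g v'∈g adj same = proper v v' v∈g v'∈g adj (merge-colour-injective m≢w (off-vertex v∈g) (off-vertex v'∈g) same)
  ... | k' , c' , proper'' , k'+|ms|≡k = k' , c' , proper'' , trans (+-suc k' (length ms)) (cong suc k'+|ms|≡k)

-- 3. Joins.  Γ is a graph with symmetric irreflexive adjacency whose vertices split into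
-- a decidable set U, each member adjacent to every other vertex, and the rest
-- R.  ΓR is the graph on R with the adjacency of Γ.

module Join {V : Set} (_≟_ : DecidableEquality V) (Γ : Graph V) (U R : V → Set) (U? : Decidable U)
  (adj-sym      : ∀ {v w} → Graph.Adj Γ v w → Graph.Adj Γ w v)
  (adj-irrefl   : ∀ {v w} → Graph.Adj Γ v w → v ≢ w)
  (U⇒Vtx        : ∀ {u} → U u → Graph.Vtx Γ u)
  (U-universal  : ∀ {u w} → U u → Graph.Vtx Γ w → u ≢ w → Graph.Adj Γ u w)
  (R⇒Vtx        : ∀ {v} → R v → Graph.Vtx Γ v)
  (R⇒¬U         : ∀ {v} → R v → ¬ U v)
  (Vtx¬U⇒R      : ∀ {v} → Graph.Vtx Γ v → ¬ U v → R v)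
  where
  open Graph Γ

  ΓR : Graph V
  ΓR = record { Vtx = R ; Adj = Adj }

  U-R-adj : ∀ {u v} → U u → R v → Adj u v
  U-R-adj uu rv = U-universal uu (R⇒Vtx rv) (λ { refl → R⇒¬U rv uu })

  U-R-disjoint : ∀ {v} → U v → R v → ⊥
  U-R-disjoint uv rv = R⇒¬U rv uv

  vertex-count : ∀ {r q} → HasCount U r → HasCount R q → HasCount Vtx (r + q)
  vertex-count cU cR = count-resp (λ v → mk⇔ into (out v)) (count-⊎ U-R-disjoint cU cR)
    where
    into : ∀ {v} → U v ⊎ R v → Vtx v
    into (inj₁ uv) = U⇒Vtx uv
    into (inj₂ rv) = R⇒Vtx rv
    out : ∀ v → Vtx v → U v ⊎ R v
    out v vv with U? v
    ... | yes uv = inj₁ uv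
    ... | no ¬uv = inj₂ (Vtx¬U⇒R vv ¬uv)

  degree-universal : ∀ {m u d} → HasCount Vtx m → U u → HasDegree Γ u d → suc d ≡ m
  degree-universal {u = u} cV uu deg =
    count-unique (count-resp (λ w → mk⇔ into (out w)) (count-⊎ not-both (count-singleton u) deg)) cV
    where
    not-both : ∀ {w} → w ≡ u → Vtx w × Adj u w → ⊥
    not-both refl (_ , adj) = adj-irrefl adj refl
    into : ∀ {w} → w ≡ u ⊎ (Vtx w × Adj u w) → Vtx w
    into (inj₁ refl)      = U⇒Vtx uu
    into (inj₂ (vw , _)) = vw
    out : ∀ w → Vtx w → w ≡ u ⊎ (Vtx w × Adj u w)
    out w vw with w ≟ u
    ... | yes w≡u = inj₁ w≡u
    ... | no w≢u  = inj₂ (vw , U-universal uu vw (λ u≡w → w≢u (sym u≡w)))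

  degree-rest : ∀ {r v d dR} → HasCount U r → R v → HasDegree Γ v d → HasDegree ΓR v dR → d ≡ r + dR
  degree-rest {v = v} cU rv deg degR =
    count-unique deg (count-resp (λ w → mk⇔ into (out w)) (count-⊎ U-R-disjoint' cU degR))
    where
    U-R-disjoint' : ∀ {w} → U w → R w × Adj v w → ⊥
    U-R-disjoint' uw (rw , _) = U-R-disjoint uw rw
    into : ∀ {w} → U w ⊎ (R w × Adj v w) → Vtx w × Adj v w
    into (inj₁ uw)         = U⇒Vtx uw , adj-sym (U-R-adj uw rv)
    into (inj₂ (rw , adj)) = R⇒Vtx rw , adj
    out : ∀ w → Vtx w × Adj v w → U w ⊎ (R w × Adj v w)
    out w (vw , adj) with U? w
    ... | yes uw = inj₁ uw
    ... | no ¬uw = inj₂ (Vtx¬U⇒R vw ¬uw , adj)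

  -- Ordered pairs (u , w) of distinct vertices with u ∈ U; they are exactly
  -- the adjacent pairs starting in U.
  UPair : V × V → Set
  UPair (v , w) = (U v × Vtx w) × v ≢ w

  -- U × V(Γ) consists of the r diagonal pairs and the pairs in UPair.
  UPair-count : ∀ {r q a} → HasCount U r → HasCount R q → HasCount UPair a → r + a ≡ r * (r + q)
  UPair-count cU cR cUPair = count-unique
    (count-resp (λ x → mk⇔ into (out x)) (count-⊎ not-both (count-diagonal cU) cUPair))
    (count-× cU (vertex-count cU cR))
    where
    not-both : ∀ {x} → U (proj₁ x) × proj₁ x ≡ proj₂ x → UPair x → ⊥
    not-both (_ , v≡w) (_ , v≢w) = v≢w v≡w
    into : ∀ {x} → (U (proj₁ x) × proj₁ x ≡ proj₂ x) ⊎ UPair x → U (proj₁ x) × Vtx (proj₂ x)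
    into (inj₁ (uv , refl)) = uv , U⇒Vtx uv
    into (inj₂ (uvw , _))   = uvw
    out : ∀ x → U (proj₁ x) × Vtx (proj₂ x) → (U (proj₁ x) × proj₁ x ≡ proj₂ x) ⊎ UPair x
    out (v , w) uvw with v ≟ w
    ... | yes v≡w = inj₁ (proj₁ uvw , v≡w)
    ... | no v≢w  = inj₂ (uvw , v≢w)

  -- An adjacent ordered pair starts in U, or goes from R to U, or stays in R.
  edge-split : ∀ {r q a mR} → HasCount U r → HasCount R q → HasCount UPair a → HasCount (Edge ΓR) mR →
    HasCount (Edge Γ) (a + (q * r + mR))
  edge-split cU cR cUPair cER = count-resp (λ x → mk⇔ into (out x))
    (count-⊎ first-in-U cUPair (count-⊎ second-in-U (count-× cR cU) cER))
    where
    first-in-U : ∀ {x} → UPair x → (R (proj₁ x) × U (proj₂ x)) ⊎ Edge ΓR x → ⊥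
    first-in-U ((uv , _) , _) (inj₁ (rv , _))     = U-R-disjoint uv rv
    first-in-U ((uv , _) , _) (inj₂ (rv , _ , _)) = U-R-disjoint uv rv
    second-in-U : ∀ {x} → R (proj₁ x) × U (proj₂ x) → Edge ΓR x → ⊥
    second-in-U (_ , uw) (_ , rw , _) = U-R-disjoint uw rw
    into : ∀ {x} → UPair x ⊎ ((R (proj₁ x) × U (proj₂ x)) ⊎ Edge ΓR x) → Edge Γ x
    into (inj₁ ((uv , vw) , v≢w))      = U⇒Vtx uv , vw , U-universal uv vw v≢w
    into (inj₂ (inj₁ (rv , uw)))       = R⇒Vtx rv , U⇒Vtx uw , adj-sym (U-R-adj uw rv)
    into (inj₂ (inj₂ (rv , rw , adj))) = R⇒Vtx rv , R⇒Vtx rw , adj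
    out : ∀ x → Edge Γ x → UPair x ⊎ ((R (proj₁ x) × U (proj₂ x)) ⊎ Edge ΓR x)
    out (v , w) (vv , vw , adj) with U? v | U? w
    ... | yes uv | _      = inj₁ ((uv , vw) , adj-irrefl adj)
    ... | no ¬uv | yes uw = inj₂ (inj₁ (Vtx¬U⇒R vv ¬uv , uw))
    ... | no ¬uv | no ¬uw = inj₂ (inj₂ (Vtx¬U⇒R vv ¬uv , Vtx¬U⇒R vw ¬uw , adj))

  ordered-edge-identity : ∀ {r q m mR} → HasCount U r → HasCount R q →
    HasCount (Edge Γ) m → HasCount (Edge ΓR) mR → r + m ≡ r * (r + q) + q * r + mR
  ordered-edge-identity {r} {q} {m} {mR} cU cR cE cER
    with count-filter (λ (v , w) → ¬? (v ≟ w)) (count-× cU (vertex-count cU cR))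
  ... | a , cUPair = begin
    r + m                      ≡⟨ cong (λ z → r + z) (count-unique cE (edge-split cU cR cUPair cER)) ⟩
    r + (a + (q * r + mR))     ≡⟨ +-assoc r a (q * r + mR) ⟨
    (r + a) + (q * r + mR)     ≡⟨ cong (_+ (q * r + mR)) (UPair-count cU cR cUPair) ⟩
    r * (r + q) + (q * r + mR) ≡⟨ +-assoc (r * (r + q)) (q * r) mR ⟨
    r * (r + q) + q * r + mR   ∎
    where open ≡-Reasoning

  -- An independent set of Γ with two or more vertices avoids U, since a vertex
  -- of U is adjacent to every other vertex.
  independent-avoids-U : ∀ {x y zs} → Independent Γ (x ∷ y ∷ zs) → All (λ v → ¬ U v) (x ∷ y ∷ zs)
  independent-avoids-U {x} {y} {zs} (((x∉ ∷ _) , vertices) , indep) = All.tabulate avoid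
    where
    xs : List V
    xs = x ∷ y ∷ zs
    x≢y : x ≢ y
    x≢y = All.lookup x∉ (here refl)
    nonadjacent : ∀ {u v} → u ∈ xs → v ∈ xs → u ≢ v → U u → ⊥
    nonadjacent {u} {v} u∈ v∈ u≢v uu with ∈-AllPairs₂ indep u∈ v∈
    ... | inj₁ u≡v        = u≢v u≡v
    ... | inj₂ (inj₁ ¬uv) = ¬uv (U-universal uu (All.lookup vertices v∈) u≢v)
    ... | inj₂ (inj₂ ¬vu) = ¬vu (adj-sym (U-universal uu (All.lookup vertices v∈) u≢v))
    avoid : ∀ {u} → u ∈ xs → ¬ U u
    avoid {u} u∈ uu with u ≟ x
    ... | yes refl = nonadjacent u∈ (there (here refl)) x≢y uu
    ... | no u≢x   = nonadjacent u∈ (here refl) u≢x uu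

  independence-number : ∃ R → ∀ {a aR} → IsIndependenceNumber Γ a → IsIndependenceNumber ΓR aR → a ≡ aR
  independence-number (w , rw) ((xs , indep-xs , refl) , maxΓ) ((ys , ((uys , rys) , indep-ys) , refl) , maxR) =
    ≤-antisym (bounded xs indep-xs) (maxΓ ys ((uys , All.map R⇒Vtx rys) , indep-ys))
    where
    -- singletons are bounded by the independent set {w} of ΓR; larger sets lie in R
    bounded : ∀ zs → Independent Γ zs → length zs ≤ length ys
    bounded []      _ = z≤n
    bounded (_ ∷ []) _ = maxR (w ∷ []) ((([] ∷ []) , (rw ∷ [])) , ([] ∷ []))
    bounded zs@(_ ∷ _ ∷ _) indep@((uzs , vzs) , pairs) = maxR zs ((uzs , All.tabulate in-R) , pairs)
      where
      in-R : ∀ {z} → z ∈ zs → R z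
      in-R z∈ = Vtx¬U⇒R (All.lookup vzs z∈) (All.lookup (independent-avoids-U indep) z∈)

  -- ω(Γ) = |U| + ω(ΓR): a clique splits into its U-part and a clique of ΓR,
  -- and U together with a clique of ΓR is a clique.
  clique-number : ∀ {r} → HasCount U r → ∀ {c cR} → IsCliqueNumber Γ c → IsCliqueNumber ΓR cR → c ≡ r + cR
  clique-number (us , (uus , us-enum) , refl) ((xs , ((uxs , vxs) , pairs) , refl) , maxΓ)
                ((ys , ((uys , rys) , pairsR) , refl) , maxR) = ≤-antisym upper lower
    where
    ¬U? : Decidable (λ v → ¬ U v)
    ¬U? v = ¬? (U? v)
    U-part-bounded : length (filter U? xs) ≤ length us
    U-part-bounded = length-≤-⊆ (Unique.filter⁺ U? uxs) (λ {v} v∈ → to (us-enum v) (proj₂ (∈-filter⁻ U? {xs = xs} v∈)))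
    R-part-clique : Clique ΓR (filter ¬U? xs)
    R-part-clique = (Unique.filter⁺ ¬U? uxs , All.tabulate in-R) , AllPairs.filter⁺ ¬U? pairs
      where
      in-R : ∀ {v} → v ∈ filter ¬U? xs → R v
      in-R v∈ = let (v∈xs , ¬uv) = ∈-filter⁻ ¬U? {xs = xs} v∈ in Vtx¬U⇒R (All.lookup vxs v∈xs) ¬uv
    upper : length xs ≤ length us + length ys
    upper = subst (_≤ length us + length ys) (length-filter-split U? xs)
                  (+-mono-≤ U-part-bounded (maxR (filter ¬U? xs) R-part-clique))
    U-clique : AllPairs Adj us
    U-clique = allPairs-of-distinct Γ uus
      (λ {u} {u'} u∈ u'∈ u≢u' → U-universal (from (us-enum u) u∈) (U⇒Vtx (from (us-enum u') u'∈)) u≢u')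
    disjoint : ∀ {v} → ¬ (v ∈ us × v ∈ ys)
    disjoint {v} (v∈us , v∈ys) = U-R-disjoint (from (us-enum v) v∈us) (All.lookup rys v∈ys)
    joined-clique : Clique Γ (us ++ ys)
    joined-clique =
      (Unique.++⁺ uus uys disjoint , All.++⁺ (All.tabulate (λ {u} u∈ → U⇒Vtx (from (us-enum u) u∈))) (All.map R⇒Vtx rys)) ,
      AllPairs.++⁺ U-clique pairsR (All.tabulate (λ {u} u∈ → All.map (U-R-adj (from (us-enum u) u∈)) rys))
    lower : length us + length ys ≤ length xs
    lower = subst (_≤ length xs) (length-++ us) (maxΓ (us ++ ys) joined-clique)

  -- χ(Γ) = |U| + χ(ΓR): give U its own |U| colours and colour R as in ΓR; conversely
  -- the colours of U are distinct and unused on R, so they can be dropped.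
  chromatic-number : ∃ R → ∀ {r} → HasCount U r → ∀ {c cR} →
    IsChromaticNumber Γ c → IsChromaticNumber ΓR cR → c ≡ r + cR
  chromatic-number (w , rw) (us , (uus , us-enum) , refl) {c} {cR} ((col , proper) , minΓ) ((colR , properR) , minR) =
    ≤-antisym upper lower
    where
    r : ℕ
    r = length us
    split-colour : V → Fin r ⊎ Fin cR
    split-colour v with U? v
    ... | yes uv = inj₁ (index (to (us-enum v) uv))
    ... | no _   = inj₂ (colR v)
    split-colour-proper : ∀ v v' → Vtx v → Vtx v' → Adj v v' → split-colour v ≢ split-colour v'
    split-colour-proper v v' vv vv' adj with U? v | U? v'
    ... | yes uv | yes uv' = λ same → adj-irrefl adj (begin
            v                                    ≡⟨ lookup-index (to (us-enum v) uv) ⟩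
            lookup us (index (to (us-enum v) uv))    ≡⟨ cong (lookup us) (inj₁-injective same) ⟩
            lookup us (index (to (us-enum v') uv'))  ≡⟨ lookup-index (to (us-enum v') uv') ⟨
            v'                                   ∎)
      where open ≡-Reasoning
    ... | yes _  | no _    = λ ()
    ... | no _   | yes _   = λ ()
    ... | no ¬uv | no ¬uv' = λ same → properR v v' (Vtx¬U⇒R vv ¬uv) (Vtx¬U⇒R vv' ¬uv') adj (inj₂-injective same)
    join-injective : ∀ {i j} → join r cR i ≡ join r cR j → i ≡ j
    join-injective {i} {j} same = trans (sym (splitAt-join r cR i)) (trans (cong (splitAt r) same) (splitAt-join r cR j))
    upper : c ≤ r + cR
    upper = minΓ (r + cR) (λ v → join r cR (split-colour v))
      (λ v v' vv vv' adj same → split-colour-proper v v' vv vv' adj (join-injective same))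
    U-unused-on-R : ∀ {m v} → m ∈ us → R v → col v ≢ col m
    U-unused-on-R {m} {v} m∈ rv =
      let um = from (us-enum m) m∈ in proper v m (R⇒Vtx rv) (U⇒Vtx um) (adj-sym (U-R-adj um rv))
    U-distinct : ∀ {m m'} → m ∈ us → m' ∈ us → m ≢ m' → col m ≢ col m'
    U-distinct {m} {m'} m∈ m'∈ m≢m' =
      let um = from (us-enum m) m∈ ; um' = from (us-enum m') m'∈ in
      proper m m' (U⇒Vtx um) (U⇒Vtx um') (U-universal um (U⇒Vtx um') m≢m')
    lower : r + cR ≤ c
    lower with drop-colours ΓR rw us uus c col U-unused-on-R U-distinct
                 (λ v v' rv rv' adj → proper v v' (R⇒Vtx rv) (R⇒Vtx rv') adj)
    ... | k' , col' , proper' , k'+r≡c =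
      subst (r + cR ≤_) (trans (+-comm r k') k'+r≡c) (+-monoʳ-≤ r (minR k' col' proper'))

  -- γ(Γ) = 1 when U is non-empty: any vertex of U dominates.
  domination-number : ∃ U → IsDominationNumber Γ 1
  domination-number (u , uu) = (u ∷ [] , ((([] ∷ []) , (U⇒Vtx uu ∷ [])) , dominates) , refl) , nonempty
    where
    dominates : ∀ v → Vtx v → v ∈ u ∷ [] ⊎ ∃ λ w → w ∈ u ∷ [] × Adj w v
    dominates v vv with v ≟ u
    ... | yes v≡u = inj₁ (here v≡u)
    ... | no v≢u  = inj₂ (u , here refl , U-universal uu vv (λ u≡v → v≢u (sym u≡v)))
    nonempty : ∀ xs → Dominating Γ xs → 1 ≤ length xs
    nonempty []      (_ , dominating) with dominating u (U⇒Vtx uu)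
    ... | inj₁ ()
    ... | inj₂ (_ , () , _)
    nonempty (_ ∷ _) _ = s≤s z≤n

-- 4. Γ(G) is the join of its proper normal subgroups with Γ_N(G).

module SubgroupFacts {n : ℕ} (G : FinGroup n) where
  open FinGroup G
  open IsGroup isGroup using (assoc; identityˡ; identityʳ; inverseˡ; inverseʳ)

  -- G as a bundled group, to use the library's derived group laws
  group : Group 0ℓ 0ℓ
  group = record { isGroup = isGroup }
  open GroupProperties group using (⁻¹-involutive; ε⁻¹≈ε)

  T : Subset n
  T = Trivial G

  _≟ₛ_ : DecidableEquality (Subset n)
  _≟ₛ_ = Vec.≡-dec Bool._≟_

  isSubgroup? : Decidable (IsSubgroup G)
  isSubgroup? H = (ε ∈? H)
    ×-dec all? (λ x → all? λ y → (x ∈? H) →-dec ((y ∈? H) →-dec ((x ∙ y) ∈? H)))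
    ×-dec all? (λ x → (x ∈? H) →-dec ((x ⁻¹) ∈? H))

  isNormal? : Decidable (IsNormal G)
  isNormal? H = isSubgroup? H ×-dec all? (λ g → all? λ h → (h ∈? H) →-dec (((g ∙ h) ∙ (g ⁻¹)) ∈? H))

  isProperNormal? : Decidable (IsProperNormal G)
  isProperNormal? H = isNormal? H ×-dec ¬? (H ≟ₛ T) ×-dec ¬? (H ≟ₛ Full)

  trivial-normal : IsNormal G T
  trivial-normal = (x∈⁅x⁆ ε , closed-∙ , closed-⁻¹) , closed-conj
    where
    closed-∙ : ∀ x y → x ∈ₛ T → y ∈ₛ T → (x ∙ y) ∈ₛ T
    closed-∙ x y x∈ y∈ rewrite x∈⁅y⁆⇒x≡y ε x∈ | x∈⁅y⁆⇒x≡y ε y∈ | identityˡ ε = x∈⁅x⁆ ε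
    closed-⁻¹ : ∀ x → x ∈ₛ T → (x ⁻¹) ∈ₛ T
    closed-⁻¹ x x∈ rewrite x∈⁅y⁆⇒x≡y ε x∈ | ε⁻¹≈ε = x∈⁅x⁆ ε
    closed-conj : ∀ g h → h ∈ₛ T → ((g ∙ h) ∙ (g ⁻¹)) ∈ₛ T
    closed-conj g h h∈ rewrite x∈⁅y⁆⇒x≡y ε h∈ | identityʳ g | inverseʳ g = x∈⁅x⁆ ε

  full-subgroup : IsSubgroup G Full
  full-subgroup = ∈⊤ , (λ _ _ _ _ → ∈⊤) , λ _ _ → ∈⊤

  -- In a non-simple group {1} ≠ G, since a proper normal subgroup lies strictly between.
  trivial≢full : NonSimple G → T ≢ Full
  trivial≢full (N , ((N-subgroup , _) , N≢T , _)) T≡Full = N≢T (⊆-antisym N⊆T T⊆N)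
    where
    N⊆T : N ⊆ T
    N⊆T {x} _ = subst (x ∈ₛ_) (sym T≡Full) ∈⊤
    T⊆N : T ⊆ N
    T⊆N x∈ = subst (_∈ₛ N) (sym (x∈⁅y⁆⇒x≡y ε x∈)) (proj₁ N-subgroup)

  permute-sym : ∀ {H K} → Permute G H K → Permute G K H
  permute-sym (HK⊆KH , KH⊆HK) = KH⊆HK , HK⊆KH

  -- A normal subgroup N permutes with every subset K (in particular every
  -- subgroup): hk = k (k⁻¹hk) and kh = (khk⁻¹) k.
  normal-permutes : ∀ {N} → IsNormal G N → ∀ K → Permute G N K
  normal-permutes {N} (_ , conj) K = NK⊆KN , KN⊆NK
    where
    open ≡-Reasoning
    NK⊆KN : ∀ h k → h ∈ₛ N → k ∈ₛ K → ∃ λ k' → ∃ λ h' → k' ∈ₛ K × h' ∈ₛ N × (h ∙ k) ≡ (k' ∙ h')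
    NK⊆KN h k h∈ k∈ = k , ((k ⁻¹) ∙ h) ∙ k , k∈ ,
      subst (λ z → (((k ⁻¹) ∙ h) ∙ z) ∈ₛ N) (⁻¹-involutive k) (conj (k ⁻¹) h h∈) ,
      sym (begin
        k ∙ (((k ⁻¹) ∙ h) ∙ k)  ≡⟨ assoc k ((k ⁻¹) ∙ h) k ⟨
        (k ∙ ((k ⁻¹) ∙ h)) ∙ k  ≡⟨ cong (_∙ k) (assoc k (k ⁻¹) h) ⟨
        ((k ∙ (k ⁻¹)) ∙ h) ∙ k  ≡⟨ cong (λ z → (z ∙ h) ∙ k) (inverseʳ k) ⟩
        (ε ∙ h) ∙ k             ≡⟨ cong (_∙ k) (identityˡ h) ⟩
        h ∙ k                   ∎)
    KN⊆NK : ∀ k h → k ∈ₛ K → h ∈ₛ N → ∃ λ h' → ∃ λ k' → h' ∈ₛ N × k' ∈ₛ K × (k ∙ h) ≡ (h' ∙ k')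
    KN⊆NK k h k∈ h∈ = (k ∙ h) ∙ (k ⁻¹) , k , conj k h h∈ , k∈ ,
      sym (begin
        ((k ∙ h) ∙ (k ⁻¹)) ∙ k  ≡⟨ assoc (k ∙ h) (k ⁻¹) k ⟩
        (k ∙ h) ∙ ((k ⁻¹) ∙ k)  ≡⟨ cong ((k ∙ h) ∙_) (inverseˡ k) ⟩
        (k ∙ h) ∙ ε             ≡⟨ identityʳ (k ∙ h) ⟩
        k ∙ h                   ∎)

  -- Adjacency in Γ(G) (and Γ_N(G), which shares it) is symmetric.
  adjacent-sym : ∀ {H K} → Graph.Adj (Γ G) H K → Graph.Adj (Γ G) K H
  adjacent-sym (H≢K , HK=KH) = (λ K≡H → H≢K (sym K≡H)) , permute-sym HK=KH

  -- Γ_N(G) is a subgraph of Γ(G): a non-normal subgroup differs from {1}.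
  non-normal⇒vertex : ∀ {H} → Graph.Vtx (ΓN G) H → Graph.Vtx (Γ G) H
  non-normal⇒vertex (H-subgroup , H-non-normal , H≢G) =
    H-subgroup , (λ H≡T → H-non-normal (subst (IsNormal G) (sym H≡T) trivial-normal)) , H≢G

  non-proper-normal-vertex : ∀ {H} → Graph.Vtx (Γ G) H → ¬ IsProperNormal G H → Graph.Vtx (ΓN G) H
  non-proper-normal-vertex (H-subgroup , H≢T , H≢G) ¬proper =
    H-subgroup , (λ H-normal → ¬proper (H-normal , H≢T , H≢G)) , H≢G

  non-normal-vertex : ∀ {H} → Graph.Vtx (Γ G) H → ¬ IsNormal G H → Graph.Vtx (ΓN G) H
  non-normal-vertex H∈Γ H-non-normal = non-proper-normal-vertex H∈Γ (λ H-proper → H-non-normal (proj₁ H-proper))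

  -- Γ(G) is the join of the proper normal subgroups with Γ_N(G): adjacency is
  -- symmetric and irreflexive, and a proper normal subgroup permutes with all.
  module ΓJoin = Join _≟ₛ_ (Γ G) (IsProperNormal G) (Graph.Vtx (ΓN G)) isProperNormal?
    adjacent-sym proj₁
    (λ (N-normal , N≢T , N≢G) → proj₁ N-normal , N≢T , N≢G)
    (λ (N-normal , _) _ N≢K → N≢K , normal-permutes N-normal _)
    non-normal⇒vertex
    (λ (_ , H-non-normal , _) (H-normal , _) → H-non-normal H-normal)
    non-proper-normal-vertex

  -- Every subgroup is {1}, G or a vertex of Γ(G), and {1} ≠ G: |V(Γ(G))| = |L(G)| - 2.
  subgroup-vertex-count : NonSimple G → ∀ {L v} → HasCount (IsSubgroup G) L → HasCount (Graph.Vtx (Γ G)) v → L ≡ 2 + v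
  subgroup-vertex-count nonSimple cL cV = count-unique cL (count-resp (λ H → mk⇔ into (out H))
    (count-⊎ T-vertex (count-singleton T) (count-⊎ Full-vertex (count-singleton Full) cV)))
    where
    T-vertex : ∀ {H} → H ≡ T → H ≡ Full ⊎ Graph.Vtx (Γ G) H → ⊥
    T-vertex refl (inj₁ T≡Full)        = trivial≢full nonSimple T≡Full
    T-vertex refl (inj₂ (_ , T≢T , _)) = T≢T refl
    Full-vertex : ∀ {H} → H ≡ Full → Graph.Vtx (Γ G) H → ⊥
    Full-vertex refl (_ , _ , Full≢Full) = Full≢Full refl
    into : ∀ {H} → H ≡ T ⊎ (H ≡ Full ⊎ Graph.Vtx (Γ G) H) → IsSubgroup G H
    into (inj₁ refl)                    = proj₁ trivial-normal
    into (inj₂ (inj₁ refl))             = full-subgroup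
    into (inj₂ (inj₂ (H-subgroup , _))) = H-subgroup
    out : ∀ H → IsSubgroup G H → H ≡ T ⊎ (H ≡ Full ⊎ Graph.Vtx (Γ G) H)
    out H H-subgroup with H ≟ₛ T | H ≟ₛ Full
    ... | yes H≡T | _       = inj₁ H≡T
    ... | no _    | yes H≡G = inj₂ (inj₁ H≡G)
    ... | no H≢T  | no H≢G  = inj₂ (inj₂ (H-subgroup , H≢T , H≢G))

  -- Subgroup census: the subgroups are {1}, G, the r proper normal ones and
  -- the q proper non-normal ones, so |L(G)| = 2 + r + q.
  census : NonSimple G → ∀ {L r} → HasCount (IsSubgroup G) L → HasCount (IsProperNormal G) r →
    ∃ λ q → HasCount (Graph.Vtx (ΓN G)) q × L ≡ 2 + (r + q)
  census nonSimple cL cU with count-filter (λ H → ¬? (H ≟ₛ T) ×-dec ¬? (H ≟ₛ Full)) cL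
  ... | v , cV with count-filter (λ H → ¬? (isNormal? H)) cV
  ... | q , cNonNormal = q , cR ,
    trans (subgroup-vertex-count nonSimple cL cV) (cong (λ x → 2 + x) (count-unique cV (ΓJoin.vertex-count cU cR)))
    where
    cR : HasCount (Graph.Vtx (ΓN G)) q
    cR = count-resp (λ H → mk⇔ (λ ((H-subgroup , _ , H≢G) , H-non-normal) → H-subgroup , H-non-normal , H≢G)
                                 (λ H∈ΓN@(_ , H-non-normal , _) → non-normal⇒vertex H∈ΓN , H-non-normal))
                    cNonNormal

-- From r + 2e = r(r + q) + qr + 2e_N and |L| = 2 + r + q we get
-- 2e = 2e_N + r(2|L| - r - 5), the paper's formula multiplied by 2.
edge-formula : ∀ {e eN r q} → r + 2 * e ≡ r * (r + q) + q * r + 2 * eN →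
  + (2 * e) ≡ + (2 * eN) +ℤ (+ r *ℤ (+ (2 * (2 + (r + q))) - + r - + 5))
edge-formula {e} {eN} {r} {q} identity = begin
  + (2 * e)                                                ≡⟨ cancel-r (+ (2 * e)) ⟩
  (+ r +ℤ + (2 * e)) - + r                                 ≡⟨ cong (_- + r) (ℤ.pos-+ r (2 * e)) ⟨
  + (r + 2 * e) - + r                                      ≡⟨ cong (λ z → + z - + r) identity ⟩
  + (r * (r + q) + q * r + 2 * eN) - + r                   ≡⟨ cong (_- + r) lhs-cast ⟩
  (R *ℤ (R +ℤ Q) +ℤ Q *ℤ R +ℤ + (2 * eN)) - R              ≡⟨ rearrange R Q (+ (2 * eN)) ⟩
  + (2 * eN) +ℤ (R *ℤ (+ 2 *ℤ (+ 2 +ℤ (R +ℤ Q)) - R - + 5)) ≡⟨ cong (λ z → + (2 * eN) +ℤ (R *ℤ (z - R - + 5))) rhs-cast ⟨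
  + (2 * eN) +ℤ (R *ℤ (+ (2 * (2 + (r + q))) - R - + 5))   ∎
  where
  open ≡-Reasoning
  open +-*-Solver
  R Q : ℤ
  R = + r
  Q = + q
  cancel-r : ∀ E → E ≡ (R +ℤ E) - R
  cancel-r = solve 2 (λ R E → E := (R :+ E) :- R) refl R
  rearrange : ∀ R Q N → (R *ℤ (R +ℤ Q) +ℤ Q *ℤ R +ℤ N) - R ≡ N +ℤ (R *ℤ (+ 2 *ℤ (+ 2 +ℤ (R +ℤ Q)) - R - + 5))
  rearrange = solve 3 (λ R Q N → (R :* (R :+ Q) :+ Q :* R :+ N) :- R
                                 := N :+ (R :* (con (+ 2) :* (con (+ 2) :+ (R :+ Q)) :- R :- con (+ 5)))) refl
  lhs-cast : + (r * (r + q) + q * r + 2 * eN) ≡ R *ℤ (R +ℤ Q) +ℤ Q *ℤ R +ℤ + (2 * eN)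
  lhs-cast = begin
    + (r * (r + q) + q * r + 2 * eN)              ≡⟨ ℤ.pos-+ (r * (r + q) + q * r) (2 * eN) ⟩
    + (r * (r + q) + q * r) +ℤ + (2 * eN)         ≡⟨ cong (_+ℤ + (2 * eN)) (ℤ.pos-+ (r * (r + q)) (q * r)) ⟩
    + (r * (r + q)) +ℤ + (q * r) +ℤ + (2 * eN)    ≡⟨ cong (λ z → z +ℤ + (q * r) +ℤ + (2 * eN)) (ℤ.pos-* r (r + q)) ⟩
    R *ℤ + (r + q) +ℤ + (q * r) +ℤ + (2 * eN)     ≡⟨ cong (λ z → R *ℤ z +ℤ + (q * r) +ℤ + (2 * eN)) (ℤ.pos-+ r q) ⟩
    R *ℤ (R +ℤ Q) +ℤ + (q * r) +ℤ + (2 * eN)      ≡⟨ cong (λ z → R *ℤ (R +ℤ Q) +ℤ z +ℤ + (2 * eN)) (ℤ.pos-* q r) ⟩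
    R *ℤ (R +ℤ Q) +ℤ Q *ℤ R +ℤ + (2 * eN)         ∎
  rhs-cast : + (2 * (2 + (r + q))) ≡ + 2 *ℤ (+ 2 +ℤ (R +ℤ Q))
  rhs-cast = begin
    + (2 * (2 + (r + q)))       ≡⟨ ℤ.pos-* 2 (2 + (r + q)) ⟩
    + 2 *ℤ + (2 + (r + q))      ≡⟨ cong (+ 2 *ℤ_) (ℤ.pos-+ 2 (r + q)) ⟩
    + 2 *ℤ (+ 2 +ℤ + (r + q))   ≡⟨ cong (λ z → + 2 *ℤ (+ 2 +ℤ z)) (ℤ.pos-+ r q) ⟩
    + 2 *ℤ (+ 2 +ℤ (R +ℤ Q))    ∎

-- A predicate counted by q with r ≠ r + q is satisfiable.  Since |L(G)| = 2 + r + q,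
-- this turns r ≠ |L(G)| - 2 into the existence of a proper non-normal subgroup.
count-nonzero-excess : ∀ {A : Set} {P : A → Set} {r q} → r ≢ r + q → HasCount P q → ∃ P
count-nonzero-excess {q = zero}  r≢r+0 _  = ⊥-elim (r≢r+0 (sym (+-identityʳ _)))
count-nonzero-excess {q = suc _} _     cP = count-nonzero cP

corollary3p1 :
    ∀ {n : ℕ} (G : FinGroup n) → NonSimple G →
    ∀ (L r : ℕ) → HasCount (IsSubgroup G) L → HasCount (IsProperNormal G) r →
    r ≢ L ∸ 2 →
    -- (i)
    (∀ H → Graph.Vtx (Γ G) H →
         (IsNormal G H → ∀ d → HasDegree (Γ G) H d → d ≡ L ∸ 3)
       × (¬ IsNormal G H → ∀ d dN → HasDegree (Γ G) H d → HasDegree (ΓN G) H dN → d ≡ r + dN))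
    -- (ii)  |E(Γ)| = |E(Γ_N)| + (r/2)(2|L| - r - 5), multiplied by 2, in ℤ
    × (∀ e eN → HasEdgeCount (Γ G) e → HasEdgeCount (ΓN G) eN →
         + (2 * e) ≡ + (2 * eN) +ℤ (+ r *ℤ (+ (2 * L) - + r - + 5)))
    -- (iii)
    × (∀ a aN → IsIndependenceNumber (Γ G) a → IsIndependenceNumber (ΓN G) aN → a ≡ aN)
    -- (iv)
    × (∀ w wN → IsCliqueNumber (Γ G) w → IsCliqueNumber (ΓN G) wN → w ≡ r + wN)
    -- (v)
    × (∀ c cN → IsChromaticNumber (Γ G) c → IsChromaticNumber (ΓN G) cN → c ≡ r + cN)
    -- (vi)
    × IsDominationNumber (Γ G) 1
-- By the census |L(G)| = 2 + r + q; each part is then the corresponding fact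
-- about the join Γ(G) of the r proper normal subgroups with Γ_N(G).
corollary3p1 G nonSimple L r cL cU r≢L∸2 with SubgroupFacts.census G nonSimple cL cU
... | q , cR , refl =
  degrees ,
  (λ e eN cE cEN → edge-formula {e} {eN} {r} {q}
     (ordered-edge-identity cU cR (edges-as-ordered-pairs (Γ G) adjacent-sym cE)
                                  (edges-as-ordered-pairs (ΓN G) adjacent-sym cEN))) ,
  (λ a aN → independence-number R-nonempty {a} {aN}) ,
  (λ w wN → clique-number cU {w} {wN}) ,
  (λ c cN → chromatic-number R-nonempty cU {c} {cN}) ,
  domination-number nonSimple
  where
  open SubgroupFacts G
  open ΓJoin
  R-nonempty : ∃ (Graph.Vtx (ΓN G))
  R-nonempty = count-nonzero-excess r≢L∸2 cR
  degrees : ∀ H → Graph.Vtx (Γ G) H →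
         (IsNormal G H → ∀ d → HasDegree (Γ G) H d → d ≡ (2 + (r + q)) ∸ 3)
       × (¬ IsNormal G H → ∀ d dN → HasDegree (Γ G) H d → HasDegree (ΓN G) H dN → d ≡ r + dN)
  degrees H H∈Γ@(_ , H≢T , H≢G) =
    (λ H-normal d deg → cong (_∸ 1) (degree-universal (vertex-count cU cR) (H-normal , H≢T , H≢G) deg)) ,
    (λ H-non-normal d dN → degree-rest cU (non-normal-vertex H∈Γ H-non-normal))
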